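{- Let $\pi$ be a cycle-alternating signed permutation of size $n\ge1$ having exactly one cycle. Then $n$ is even if and only if this cycle is a two-orbit cycle, and $n$ is odd if and only if it is a one-orbit cycle.
   Context: A signed permutation of size $n$ is a bijection $\pi$ of $\{ -n,\dots,-1,1,\dots,n\}$ with $\pi(-i)=-\pi(i)$. For an orbit $O$ of $\pi$ let $-O=\{ -x:x\in O\}$, which is also an orbit. A cycle of $\pi$ is an unordered pair of orbits $\{O_1,O_2\}$ with $O_2=-O_1$; it is a one-orbit cycle if $O_1=O_2$ and a two-orbit cycle otherwise. An element $i$ is a cycle peak if $\pi^{ -1}(i)<i>\pi(i)$ and a cycle valley if $\pi^{ -1}(i)>i<\pi(i)$; $\pi$ is cycle-alternating if every $i\in\{ -n,\dots,-1,1,\dots,n\}$ is a cycle peak or a cycle valley. -}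

module Defs where

open import Data.Nat using (ℕ; suc; _^_)
open import Data.Nat.Divisibility using (_∣_)
open import Data.Fin using (Fin; toℕ)
open import Data.Bool using (Bool; true; false; not)
open import Data.Product using (_×_; _,_; ∃)
open import Data.Sum using (_⊎_)
open import Data.Integer as ℤ using (ℤ; +_; -_)
open import Relation.Binary.PropositionalEquality using (_≡_)
open import Relation.Nullary using (¬_)

-- Elements of {-n,…,-1,1,…,n}: a sign (true = negative) and a magnitude index
-- i : Fin n standing for the absolute value (toℕ i + 1).
Elt : ℕ → Set
Elt n = Bool × Fin n

val : ∀ {n} → Elt n → ℤ
val (false , i) = + suc (toℕ i)
val (true  , i) = - (+ suc (toℕ i))

neg : ∀ {n} → Elt n → Elt n
neg (s , i) = (not s , i)

record SignedPerm (n : ℕ) : Set where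
  field
    fun     : Elt n → Elt n
    inv     : Elt n → Elt n
    inv-fun : ∀ x → inv (fun x) ≡ x
    fun-inv : ∀ x → fun (inv x) ≡ x
    odd     : ∀ x → fun (neg x) ≡ neg (fun x)
open SignedPerm public

iter : ∀ {n} → SignedPerm n → ℕ → Elt n → Elt n
iter π ℕ.zero    x = x
iter π (ℕ.suc k) x = fun π (iter π k x)

InOrbit : ∀ {n} → SignedPerm n → Elt n → Elt n → Set
InOrbit π x y = ∃ λ k → iter π k x ≡ y

CyclePeak : ∀ {n} → SignedPerm n → Elt n → Set
CyclePeak π i = (val (inv π i) ℤ.< val i) × (val (fun π i) ℤ.< val i)

CycleValley : ∀ {n} → SignedPerm n → Elt n → Set
CycleValley π i = (val i ℤ.< val (inv π i)) × (val i ℤ.< val (fun π i))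

CycleAlternating : ∀ {n} → SignedPerm n → Set
CycleAlternating π = ∀ i → CyclePeak π i ⊎ CycleValley π i

-- The cycle containing x is the pair {O, -O} with O the orbit of x.
-- It is a one-orbit cycle iff O = -O, i.e. iff -x ∈ O(x);
-- otherwise (O and -O disjoint) it is a two-orbit cycle.
OneOrbitCycleOf : ∀ {n} → SignedPerm n → Elt n → Set
OneOrbitCycleOf π x = InOrbit π x (neg x)

TwoOrbitCycleOf : ∀ {n} → SignedPerm n → Elt n → Set
TwoOrbitCycleOf π x = ¬ InOrbit π x (neg x)

HasExactlyOneCycle : ∀ {n} → SignedPerm n → Set
HasExactlyOneCycle π = ∃ λ x → ∀ y → InOrbit π x y ⊎ InOrbit π (neg x) y

Even : ℕ → Set
Even n = 2 ∣ n

Odd : ℕ → Set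
Odd n = ¬ (2 ∣ n)

-- Along an orbit of a cycle-alternating π peaks and valleys alternate, and x ↦ -x swaps
-- them. So every return time π^k x = x is even, and every m with π^m x = -x is odd.
-- If the single cycle has two orbits O and -O, they split the 2n elements evenly, so the
-- period of x is n, which is even. If it has one orbit, the period p of x is 2n, and
-- π^m x = -x with 0 < m < p gives π^(2m) x = x with 0 < 2m < 2p, so 2m = p and n = m is odd.

module Submission where

open import Defs
open import Data.Bool using (Bool; true; false)
import Data.Bool as Bool
open import Data.Bool.Properties using (not-involutive)
open import Data.Fin as Fin using (Fin; toℕ; fromℕ<)
open import Data.Fin.Permutation using (↔⇒≡)
open import Data.Fin.Properties using (2↔Bool; *↔×; pigeonhole; any?; toℕ<n; toℕ-fromℕ<; toℕ-injective)
import Data.Integer as ℤ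
import Data.Integer.Properties as ℤ
open import Data.Nat using (ℕ; zero; suc; parity; _+_; _*_; _<_; _≤_; _≥_; _<?_; z<s; z≤n; s≤s; NonZero; >-nonZero)
open import Data.Nat.Divisibility using (_∣_; _∣0; divides; m%n≡0⇒n∣m)
open import Data.Nat.DivMod using (_%_; _/_; m≡m%n+[m/n]*n; m%n<n)
open import Data.Nat.Induction using (<-rec)
open import Data.Nat.Properties
  using (≤-total; ≤-refl; ≤-trans; ≤-<-trans; m≤n+m; m≤m+n; ≤⇒≯; n≢0⇒n>0; +-identityʳ; +-suc; +-comm; *-suc;
         *-monoˡ-≤; *-cancelˡ-≡; +-mono-<; m≤n⇒∃[o]m+o≡n; anyUpTo?)
  renaming (_≟_ to _≟ℕ_)
open import Data.Parity using (Parity; 0ℙ; 1ℙ; _⁻¹)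
import Data.Parity.Base as ℙ
import Data.Parity.Properties as ℙ
open import Data.Product using (_×_; _,_; ∃; proj₁; proj₂)
open import Data.Product.Function.NonDependent.Propositional using (_×-↔_)
open import Data.Product.Properties using (≡-dec)
open import Data.Sum using (_⊎_; inj₁; inj₂; [_,_]′)
open import Function.Base using (_∘_)
open import Function.Bundles using (_↔_; Inverse; Injection; _⇔_; mk⇔; mk↔ₛ′)
open import Function.Properties.Inverse using (↔⇒↣)
open import Function.Construct.Composition using (_↔-∘_)
open import Function.Construct.Identity using (↔-id)
open import Function.Construct.Symmetry using (↔-sym)
open import Function.Definitions using (Injective)
open import Relation.Binary.PropositionalEquality
open import Relation.Nullary using (¬_; Dec; yes; no; _×-dec_)
open import Relation.Nullary.Decidable using (decidable-stable; map′)
open import Relation.Nullary.Negation using (contradiction)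
open import Relation.Unary using (Pred; Decidable)

private
  variable
    n : ℕ

least-witness : ∀ {ℓ} {P : Pred ℕ ℓ} → Decidable P →
                ∀ {m} → P m → ∃ λ k → P k × (∀ {j} → j < k → ¬ P j)
least-witness {P = P} P? = <-rec (λ m → P m → ∃ λ k → P k × (∀ {j} → j < k → ¬ P j)) step _
  where
  step : ∀ m → (∀ {j} → j < m → P j → ∃ λ k → P k × (∀ {i} → i < k → ¬ P i)) →
         P m → ∃ λ k → P k × (∀ {j} → j < k → ¬ P j)
  step m smaller Pm with anyUpTo? P? m
  ... | yes (j , j<m , Pj) = smaller j<m Pj
  ... | no none            = m , Pm , λ j<m Pj → none (_ , j<m , Pj)

m∣n∧0<n<2m⇒n≡m : ∀ {m n} → m ∣ n → 0 < n → n < 2 * m → n ≡ m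
m∣n∧0<n<2m⇒n≡m (divides zero refl)              ()
m∣n∧0<n<2m⇒n≡m (divides (suc zero) refl)        _ _    = +-identityʳ _
m∣n∧0<n<2m⇒n≡m {m} (divides (suc (suc c)) refl) _ n<2m =
  contradiction n<2m (≤⇒≯ (*-monoˡ-≤ m {2} {2 + c} (s≤s (s≤s z≤n))))

parity≡0ℙ⇒2∣ : ∀ k → parity k ≡ 0ℙ → 2 ∣ k
parity≡0ℙ⇒2∣ zero          _ = divides 0 refl
parity≡0ℙ⇒2∣ (suc (suc k)) e with parity≡0ℙ⇒2∣ k e
... | divides q refl = divides (suc q) refl

parity≡1ℙ⇒2∤ : ∀ {k} → parity k ≡ 1ℙ → ¬ 2 ∣ k
parity≡1ℙ⇒2∤ {k} e (divides q refl) with trans (sym e) (trans (ℙ.*-homo-* q 2) (ℙ.*-zeroʳ (parity q)))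
... | ()

neg-involutive : (x : Elt n) → neg (neg x) ≡ x
neg-involutive (s , i) = cong (_, i) (not-involutive s)

val-neg : (x : Elt n) → val (neg x) ≡ ℤ.- val x
val-neg (false , i) = refl
val-neg (true  , i) = refl

neg-injective : Injective _≡_ _≡_ (neg {n})
neg-injective {x = x} {y = y} e = trans (sym (neg-involutive x)) (trans (cong neg e) (neg-involutive y))

_≟ᴱ_ : (x y : Elt n) → Dec (x ≡ y)
_≟ᴱ_ = ≡-dec Bool._≟_ Fin._≟_

Elt↔Fin : Elt n ↔ Fin (2 * n)
Elt↔Fin = ↔-sym ((2↔Bool ×-↔ ↔-id _) ↔-∘ *↔×)

injective-with-section⇒↔ : ∀ {A B : Set} (f : A → B) (s : B → A) →
                           Injective _≡_ _≡_ f → (∀ y → f (s y) ≡ y) → A ↔ B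
injective-with-section⇒↔ f s f-injective f∘s≗id = mk↔ₛ′ f s f∘s≗id (λ x → f-injective (f∘s≗id (f x)))

record MinimalPeriod (π : SignedPerm n) (x : Elt n) : Set where
  field
    period       : ℕ
    {{period≢0}} : NonZero period
    returns      : iter π period x ≡ x
    minimal      : ∀ {k} → 0 < k → k < period → iter π k x ≢ x

module _ (π : SignedPerm n) where

  fun-injective : Injective _≡_ _≡_ (fun π)
  fun-injective {x} {y} e = begin
    x                  ≡⟨ inv-fun π x ⟨
    inv π (fun π x)    ≡⟨ cong (inv π) e ⟩
    inv π (fun π y)    ≡⟨ inv-fun π y ⟩
    y                  ∎
    where open ≡-Reasoning

  inv-neg : ∀ x → inv π (neg x) ≡ neg (inv π x)
  inv-neg x = fun-injective (trans (fun-inv π (neg x)) (sym (trans (odd π (inv π x)) (cong neg (fun-inv π x)))))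

  iter-+ : ∀ a b x → iter π (a + b) x ≡ iter π a (iter π b x)
  iter-+ zero    b x = refl
  iter-+ (suc a) b x = cong (fun π) (iter-+ a b x)

  iter-injective : ∀ k → Injective _≡_ _≡_ (iter π k)
  iter-injective zero    e = e
  iter-injective (suc k) e = iter-injective k (fun-injective e)

  iter-neg : ∀ k x → iter π k (neg x) ≡ neg (iter π k x)
  iter-neg zero    x = refl
  iter-neg (suc k) x = trans (cong (fun π) (iter-neg k x)) (odd π (iter π k x))

  iter-*-period : ∀ {p x} → iter π p x ≡ x → ∀ c → iter π (c * p) x ≡ x
  iter-*-period per zero    = refl
  iter-*-period {p} {x} per (suc c) = trans (iter-+ p (c * p) x) (trans (cong (iter π p) (iter-*-period per c)) per)

  iter-%-period : ∀ {p x} .{{_ : NonZero p}} → iter π p x ≡ x → ∀ k → iter π (k % p) x ≡ iter π k x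
  iter-%-period {p} {x} per k = begin
    iter π (k % p) x                           ≡⟨ cong (iter π (k % p)) (iter-*-period per (k / p)) ⟨
    iter π (k % p) (iter π (k / p * p) x)      ≡⟨ iter-+ (k % p) (k / p * p) x ⟨
    iter π (k % p + k / p * p) x               ≡⟨ cong (λ m → iter π m x) (m≡m%n+[m/n]*n k p) ⟨
    iter π k x                                 ∎
    where open ≡-Reasoning

  has-period : ∀ x → ∃ λ d → iter π (suc d) x ≡ x
  has-period x with pigeonhole ≤-refl (λ i → Inverse.to Elt↔Fin (iter π (toℕ i) x))
  ... | i , j , i<j , e with m≤n⇒∃[o]m+o≡n i<j
  ...   | d , 1+i+d≡j = d , sym (iter-injective (toℕ i) (begin
    iter π (toℕ i) x                   ≡⟨ Injection.injective (↔⇒↣ Elt↔Fin) e ⟩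
    iter π (toℕ j) x                   ≡⟨ cong (λ m → iter π m x) 1+i+d≡j ⟨
    iter π (suc (toℕ i + d)) x         ≡⟨ cong (λ m → iter π m x) (+-suc (toℕ i) d) ⟨
    iter π (toℕ i + suc d) x           ≡⟨ iter-+ (toℕ i) (suc d) x ⟩
    iter π (toℕ i) (iter π (suc d) x)  ∎))
    where open ≡-Reasoning

  InOrbit-sym : ∀ {x y} → InOrbit π x y → InOrbit π y x
  InOrbit-sym {x} (k , refl) with has-period x
  ... | d , per = k * d , (begin
    iter π (k * d) (iter π k x)  ≡⟨ iter-+ (k * d) k x ⟨
    iter π (k * d + k) x         ≡⟨ cong (λ m → iter π m x) (trans (+-comm (k * d) k) (sym (*-suc k d))) ⟩
    iter π (k * suc d) x         ≡⟨ iter-*-period per k ⟩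
    x                            ∎)
    where open ≡-Reasoning

  InOrbit-trans : ∀ {x y z} → InOrbit π x y → InOrbit π y z → InOrbit π x z
  InOrbit-trans {x} (k , refl) (l , refl) = l + k , iter-+ l k x

  InOrbit-neg : ∀ {x y} → InOrbit π x y → InOrbit π (neg x) (neg y)
  InOrbit-neg {x} (k , refl) = k , iter-neg k x

  InOrbit-negˡ : ∀ {x y} → InOrbit π (neg x) y → InOrbit π x (neg y)
  InOrbit-negˡ {x} -x→y = subst (λ w → InOrbit π w _) (neg-involutive x) (InOrbit-neg -x→y)

  Covers : Elt n → Set
  Covers x = ∀ y → InOrbit π x y ⊎ InOrbit π (neg x) y

  Covers-along : ∀ {x y} → InOrbit π x y → Covers x → Covers y
  Covers-along x→y cov z with cov z
  ... | inj₁ x→z = inj₁ (InOrbit-trans (InOrbit-sym x→y) x→z)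
  ... | inj₂ -x→z = inj₂ (InOrbit-trans (InOrbit-neg (InOrbit-sym x→y)) -x→z)

  Covers-neg : ∀ {x} → Covers x → Covers (neg x)
  Covers-neg {x} cov z with cov z
  ... | inj₁ x→z = inj₂ (subst (λ w → InOrbit π w z) (sym (neg-involutive x)) x→z)
  ... | inj₂ -x→z = inj₁ -x→z

  one-cycle-covers : HasExactlyOneCycle π → ∀ x → Covers x
  one-cycle-covers (x₀ , cov) x with cov x
  ... | inj₁ x₀→x  = Covers-along x₀→x cov
  ... | inj₂ -x₀→x = Covers-along -x₀→x (Covers-neg cov)

  minimal-period : ∀ x → MinimalPeriod π x
  minimal-period x with has-period x
  ... | d , per with least-witness (λ k → 0 <? k ×-dec iter π k x ≟ᴱ x) {suc d} (z<s , per)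
  ...   | p , (0<p , ret) , below = record
    { period    = p
    ; period≢0  = >-nonZero 0<p
    ; returns   = ret
    ; minimal   = λ 0<k k<p e → below k<p (0<k , e)
    }

module OrbitOfMinimalPeriod {π : SignedPerm n} {x : Elt n} (mp : MinimalPeriod π x) where
  open MinimalPeriod mp

  return-below-period⇒0 : ∀ {r} → r < period → iter π r x ≡ x → r ≡ 0
  return-below-period⇒0 r<p e = decidable-stable (_ ≟ℕ 0) λ r≢0 → minimal (n≢0⇒n>0 r≢0) r<p e

  period-∣ : ∀ {k} → iter π k x ≡ x → period ∣ k
  period-∣ {k} e = m%n≡0⇒n∣m k period
    (return-below-period⇒0 (m%n<n k period) (trans (iter-%-period π returns k) e))

  index-injective-≤ : ∀ {i j} → i ≤ j → j < period → iter π i x ≡ iter π j x → i ≡ j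
  index-injective-≤ {i} i≤j j<p e with m≤n⇒∃[o]m+o≡n i≤j
  ... | d , refl = sym (trans (cong (i +_) d≡0) (+-identityʳ i))
    where
    d≡0 : d ≡ 0
    d≡0 = return-below-period⇒0 (≤-<-trans (m≤n+m d i) j<p)
            (sym (iter-injective π i (trans e (iter-+ π i d x))))

  index-injective : ∀ {i j} → i < period → j < period → iter π i x ≡ iter π j x → i ≡ j
  index-injective {i} {j} i<p j<p e with ≤-total i j
  ... | inj₁ i≤j = index-injective-≤ i≤j j<p e
  ... | inj₂ j≤i = sym (index-injective-≤ j≤i i<p (sym e))

  orbit-index : ∀ {y} → InOrbit π x y → ∃ λ (i : Fin period) → iter π (toℕ i) x ≡ y
  orbit-index (k , refl) = fromℕ< (m%n<n k period) ,
    trans (cong (λ m → iter π m x) (toℕ-fromℕ< (m%n<n k period))) (iter-%-period π returns k)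

  InOrbit? : ∀ y → Dec (InOrbit π x y)
  InOrbit? y = map′ (λ (i , e) → toℕ i , e) orbit-index (any? λ i → iter π (toℕ i) x ≟ᴱ y)

  orbit↔ : (∀ y → InOrbit π x y) → Fin period ↔ Elt n
  orbit↔ onto = injective-with-section⇒↔ (λ i → iter π (toℕ i) x) (proj₁ ∘ orbit-index ∘ onto)
    (λ e → toℕ-injective (index-injective (toℕ<n _) (toℕ<n _) e)) (proj₂ ∘ orbit-index ∘ onto)

  cycle↔ : TwoOrbitCycleOf π x → Covers π x → Elt period ↔ Elt n
  cycle↔ two cov = injective-with-section⇒↔ signed-point index signed-point-injective signed-point∘index
    where
    signed-point : Elt period → Elt n
    signed-point (false , i) = iter π (toℕ i) x
    signed-point (true  , i) = neg (iter π (toℕ i) x)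

    index : Elt n → Elt period
    index y with cov y
    ... | inj₁ x→y  = false , proj₁ (orbit-index x→y)
    ... | inj₂ -x→y = true  , proj₁ (orbit-index (InOrbit-negˡ π -x→y))

    signed-point∘index : ∀ y → signed-point (index y) ≡ y
    signed-point∘index y with cov y
    ... | inj₁ x→y  = proj₂ (orbit-index x→y)
    ... | inj₂ -x→y = trans (cong neg (proj₂ (orbit-index (InOrbit-negˡ π -x→y)))) (neg-involutive y)

    apart : ∀ i j → iter π (toℕ i) x ≢ neg (iter π (toℕ j) x)
    apart i j e = two (InOrbit-trans π (toℕ i , e) (InOrbit-sym π (toℕ j , iter-neg π (toℕ j) x)))

    same-index : ∀ {i j : Fin period} → iter π (toℕ i) x ≡ iter π (toℕ j) x → i ≡ j
    same-index e = toℕ-injective (index-injective (toℕ<n _) (toℕ<n _) e)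

    signed-point-injective : Injective _≡_ _≡_ signed-point
    signed-point-injective {false , i} {false , j} e = cong (false ,_) (same-index e)
    signed-point-injective {true  , i} {true  , j} e = cong (true ,_) (same-index (neg-injective e))
    signed-point-injective {false , i} {true  , j} e = contradiction e (apart i j)
    signed-point-injective {true  , i} {false , j} e = contradiction (sym e) (apart j i)

  one-orbit-period : (∀ y → InOrbit π x y) → period ≡ 2 * n
  one-orbit-period onto = ↔⇒≡ (Elt↔Fin ↔-∘ orbit↔ onto)

  two-orbit-period : TwoOrbitCycleOf π x → Covers π x → period ≡ n
  two-orbit-period two cov = *-cancelˡ-≡ period n 2 (↔⇒≡ (Elt↔Fin ↔-∘ (cycle↔ two cov ↔-∘ ↔-sym Elt↔Fin)))

module _ (π : SignedPerm n) where

  peak⇒¬valley : ∀ {x} → CyclePeak π x → ¬ CycleValley π x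
  peak⇒¬valley (ix<x , _) (x<ix , _) = ℤ.<-asym ix<x x<ix

  peak⇒¬peak-fun : ∀ {x} → CyclePeak π x → ¬ CyclePeak π (fun π x)
  peak⇒¬peak-fun {x} (_ , fx<x) (ifx<fx , _) =
    ℤ.<-asym fx<x (subst (λ y → val y ℤ.< val (fun π x)) (inv-fun π x) ifx<fx)

  valley⇒¬valley-fun : ∀ {x} → CycleValley π x → ¬ CycleValley π (fun π x)
  valley⇒¬valley-fun {x} (_ , x<fx) (fx<ifx , _) =
    ℤ.<-asym x<fx (subst (λ y → val (fun π x) ℤ.< val y) (inv-fun π x) fx<ifx)

  neg-reverses-< : ∀ (x y : Elt n) → val x ℤ.< val y → val (neg y) ℤ.< val (neg x)
  neg-reverses-< x y x<y = subst₂ ℤ._<_ (sym (val-neg y)) (sym (val-neg x)) (ℤ.neg-mono-< x<y)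

  peak⇒valley-neg : ∀ {x} → CyclePeak π x → CycleValley π (neg x)
  peak⇒valley-neg {x} (ix<x , fx<x) =
    subst (λ y → val (neg x) ℤ.< val y) (sym (inv-neg π x)) (neg-reverses-< (inv π x) x ix<x) ,
    subst (λ y → val (neg x) ℤ.< val y) (sym (odd π x)) (neg-reverses-< (fun π x) x fx<x)

  valley⇒peak-neg : ∀ {x} → CycleValley π x → CyclePeak π (neg x)
  valley⇒peak-neg {x} (x<ix , x<fx) =
    subst (λ y → val y ℤ.< val (neg x)) (sym (inv-neg π x)) (neg-reverses-< x (inv π x) x<ix) ,
    subst (λ y → val y ℤ.< val (neg x)) (sym (odd π x)) (neg-reverses-< x (fun π x) x<fx)

module Alternating (π : SignedPerm n) (alt : CycleAlternating π) where

  kind : Elt n → Parity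
  kind x = [ (λ _ → 1ℙ) , (λ _ → 0ℙ) ]′ (alt x)

  kind-¬peak : ∀ {x} → ¬ CyclePeak π x → kind x ≡ 0ℙ
  kind-¬peak {x} ¬peak with alt x
  ... | inj₁ peak = contradiction peak ¬peak
  ... | inj₂ _    = refl

  kind-¬valley : ∀ {x} → ¬ CycleValley π x → kind x ≡ 1ℙ
  kind-¬valley {x} ¬valley with alt x
  ... | inj₁ _      = refl
  ... | inj₂ valley = contradiction valley ¬valley

  kind-fun : ∀ x → kind (fun π x) ≡ kind x ⁻¹
  kind-fun x with alt x
  ... | inj₁ peak   = kind-¬peak (peak⇒¬peak-fun π peak)
  ... | inj₂ valley = kind-¬valley (valley⇒¬valley-fun π valley)

  kind-neg : ∀ x → kind (neg x) ≡ kind x ⁻¹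
  kind-neg x with alt x
  ... | inj₁ peak   = kind-¬peak (λ peak′ → peak⇒¬valley π peak′ (peak⇒valley-neg π peak))
  ... | inj₂ valley = kind-¬valley (peak⇒¬valley π (valley⇒peak-neg π valley))

  kind-iter : ∀ k x → kind (iter π k x) ≡ parity k ℙ.+ kind x
  kind-iter zero    x = refl
  kind-iter (suc k) x = begin
    kind (fun π (iter π k x))     ≡⟨ kind-fun (iter π k x) ⟩
    1ℙ ℙ.+ kind (iter π k x)      ≡⟨ cong (1ℙ ℙ.+_) (kind-iter k x) ⟩
    1ℙ ℙ.+ (parity k ℙ.+ kind x)  ≡⟨ ℙ.+-assoc 1ℙ (parity k) (kind x) ⟨
    1ℙ ℙ.+ parity k ℙ.+ kind x    ≡⟨ cong (ℙ._+ kind x) (ℙ.+-homo-+ 1 k) ⟨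
    parity (1 + k) ℙ.+ kind x     ∎
    where open ≡-Reasoning

  return-time-even : ∀ {k x} → iter π k x ≡ x → 2 ∣ k
  return-time-even {k} {x} e =
    parity≡0ℙ⇒2∣ k (ℙ.+-cancelʳ-≡ (kind x) (parity k) 0ℙ (trans (sym (kind-iter k x)) (cong kind e)))

  neg-time-odd : ∀ {k x} → iter π k x ≡ neg x → ¬ 2 ∣ k
  neg-time-odd {k} {x} e = parity≡1ℙ⇒2∤
    (ℙ.+-cancelʳ-≡ (kind x) (parity k) 1ℙ (trans (sym (kind-iter k x)) (trans (cong kind e) (kind-neg x))))

module CycleParity {π : SignedPerm n} (alt : CycleAlternating π) {x : Elt n}
                   (cov : Covers π x) (mp : MinimalPeriod π x) where
  open MinimalPeriod mp
  open OrbitOfMinimalPeriod mp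
  open Alternating π alt

  two-orbit⇒even : TwoOrbitCycleOf π x → Even n
  two-orbit⇒even two = subst Even (two-orbit-period two cov) (return-time-even returns)

  one-orbit⇒odd : OneOrbitCycleOf π x → Odd n
  one-orbit⇒odd one with orbit-index one
  ... | i , πᵐx≡-x = subst Odd m≡n m-odd
    where
    m : ℕ
    m = toℕ i

    m-odd : ¬ 2 ∣ m
    m-odd = neg-time-odd πᵐx≡-x

    π²ᵐx≡x : iter π (m + m) x ≡ x
    π²ᵐx≡x = begin
      iter π (m + m) x         ≡⟨ iter-+ π m m x ⟩
      iter π m (iter π m x)    ≡⟨ cong (iter π m) πᵐx≡-x ⟩
      iter π m (neg x)         ≡⟨ iter-neg π m x ⟩
      neg (iter π m x)         ≡⟨ cong neg πᵐx≡-x ⟩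
      neg (neg x)              ≡⟨ neg-involutive x ⟩
      x                        ∎
      where open ≡-Reasoning

    0<m+m : 0 < m + m
    0<m+m = ≤-trans (n≢0⇒n>0 λ m≡0 → m-odd (subst (2 ∣_) (sym m≡0) (2 ∣0))) (m≤m+n m m)

    m+m<2*period : m + m < 2 * period
    m+m<2*period = subst (m + m <_) (cong (period +_) (sym (+-identityʳ period)))
                     (+-mono-< (toℕ<n i) (toℕ<n i))

    onto : ∀ y → InOrbit π x y
    onto y with cov y
    ... | inj₁ x→y  = x→y
    ... | inj₂ -x→y = InOrbit-trans π one -x→y

    m≡n : m ≡ n
    m≡n = *-cancelˡ-≡ m n 2 (begin
      2 * m     ≡⟨ cong (m +_) (+-identityʳ m) ⟩
      m + m     ≡⟨ m∣n∧0<n<2m⇒n≡m (period-∣ π²ᵐx≡x) 0<m+m m+m<2*period ⟩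
      period    ≡⟨ one-orbit-period onto ⟩
      2 * n     ∎)
      where open ≡-Reasoning

lemma3p9 : (n : ℕ) → n ≥ 1 → (π : SignedPerm n) →
    CycleAlternating π → HasExactlyOneCycle π →
    (x : Elt n) →
    (Even n ⇔ TwoOrbitCycleOf π x) × (Odd n ⇔ OneOrbitCycleOf π x)
lemma3p9 n _ π alt one-cycle x =
  mk⇔ (λ even one → one-orbit⇒odd one even) two-orbit⇒even ,
  mk⇔ (λ odd → decidable-stable (InOrbit? (neg x)) (odd ∘ two-orbit⇒even)) one-orbit⇒odd
  where
  mp : MinimalPeriod π x
  mp = minimal-period π x
  open OrbitOfMinimalPeriod mp using (InOrbit?)
  open CycleParity alt (one-cycle-covers π one-cycle x) mp
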